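{- Let $n=n_1n_2$ with integers $n_1\geq3$, $n_2\geq1$, and let $I=(n_1)$ and $J=(n_2)$ be the ideals of $\mathbb Z_n$ generated by $n_1$ and $n_2$. If $e$ is the smallest element of $J+1$ with respect to $\leq$, then $e\in I$ and $e$ is the largest element of $I$ with respect to $\leq$.
   Context: On $\mathbb Z_n$ define the partial order $\leq$ by: $a\leq b$ iff $a=b$ or $a\equiv ab\pmod n$. $J+1=\{y+1: y\in J\}$. -}

module Defs where

open import Data.Nat using (ℕ; _+_; _*_; suc)
open import Data.Fin using (Fin; toℕ)
open import Data.Product using (∃; ∃₂; _×_)
open import Data.Sum using (_⊎_)
open import Relation.Binary.PropositionalEquality using (_≡_)

_≡_[mod_] : ℕ → ℕ → ℕ → Set
a ≡ b [mod n ] = ∃₂ λ k l → a + k * n ≡ b + l * n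

-- ℤ_n is represented by Fin n (residues 0 … n-1).
-- The partial order:  a ≤ b  iff  a = b  or  a ≡ a b (mod n)
_≼⟨_⟩_ : ∀ {n} → Fin n → ℕ → Fin n → Set
a ≼⟨ n ⟩ b = a ≡ b ⊎ (toℕ a ≡ toℕ a * toℕ b [mod n ])

InIdeal : ∀ {n} → ℕ → Fin n → Set
InIdeal {n} m x = ∃ λ k → toℕ x ≡ k * m [mod n ]

InShifted : ∀ {n} → ℕ → Fin n → Set
InShifted {n} m x = ∃ λ (y : Fin n) → InIdeal m y × (toℕ x ≡ suc (toℕ y) [mod n ])

-- Every element x of J + 1 satisfies x ≡ 1 (mod n₂), so for the minimum e and
-- x = 1 + t n₂ ≠ e the relation e ≤ x reads e t n₂ ≡ 0 (mod n). Since n₁ ≥ 3, the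
-- elements 1 + n₂ and 1 + (n₁ − 1) n₂ are distinct, so e differs from one of them;
-- either way e n₂ ≡ 0 (mod n₁ n₂), because e n₂ + e (n₁ − 1) n₂ = e n is 0. Hence
-- n₁ ∣ e. Conversely, for x = k n₁ ∈ I and e = 1 + j n₂ one has x e = x + k j n ≡ x.
module Submission where

open import Defs
open import Data.Empty using (⊥-elim)
open import Data.Fin using (Fin; toℕ)
import Data.Fin.Properties as Fin
open import Data.Nat using (ℕ; suc; _+_; _*_; _≤_; _<_; s≤s; z≤n; NonZero; _%_)
open import Data.Nat.DivMod using (_/_; _mod_; m≡m%n+[m/n]*n; m%n<n; m%n%n≡m%n;
  [m+kn]%n≡m%n; m*n%n≡0; m<n⇒m%n≡m; %-distribˡ-+; %-distribˡ-*)
open import Data.Nat.Divisibility using (_∣_; divides; *-cancelʳ-∣; m%n≡0⇒n∣m)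
open import Data.Nat.Properties
open import Data.Nat.Solver using (module +-*-Solver)
open import Data.Product using (∃; _×_; _,_)
open import Data.Sum using (inj₁; inj₂)
open import Level using (0ℓ)
open import Relation.Binary.Bundles using (Setoid)
import Relation.Binary.Construct.On as On
open import Relation.Binary.PropositionalEquality
import Relation.Binary.Reasoning.Setoid as SetoidReasoning
open import Relation.Nullary using (yes; no)
open +-*-Solver using (solve; _:*_; _:+_; _:=_; con)

module Modulo (N : ℕ) .{{_ : NonZero N}} where

  infix 4 _≈_
  _≈_ : ℕ → ℕ → Set
  a ≈ b = a % N ≡ b % N

  ≈-setoid : Setoid 0ℓ 0ℓ
  ≈-setoid = On.setoid (setoid ℕ) (_% N)

  module ≈-Reasoning = SetoidReasoning ≈-setoid

  ≡[mod]⇒≈ : ∀ {a b} → a ≡ b [mod N ] → a ≈ b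
  ≡[mod]⇒≈ {a} {b} (k , l , eq) = begin
    a % N           ≡⟨ [m+kn]%n≡m%n a k N ⟨
    (a + k * N) % N ≡⟨ cong (_% N) eq ⟩
    (b + l * N) % N ≡⟨ [m+kn]%n≡m%n b l N ⟩
    b % N           ∎
    where open ≡-Reasoning

  ≈⇒≡[mod] : ∀ {a b} → a ≈ b → a ≡ b [mod N ]
  ≈⇒≡[mod] {a} {b} eq = b / N , a / N , (begin
    a + b / N * N                 ≡⟨ cong (_+ b / N * N) (m≡m%n+[m/n]*n a N) ⟩
    a % N + a / N * N + b / N * N ≡⟨ cong (λ r → r + a / N * N + b / N * N) eq ⟩
    b % N + a / N * N + b / N * N ≡⟨ +-assoc (b % N) _ _ ⟩
    b % N + (a / N * N + b / N * N) ≡⟨ cong (b % N +_) (+-comm (a / N * N) _) ⟩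
    b % N + (b / N * N + a / N * N) ≡⟨ +-assoc (b % N) _ _ ⟨
    b % N + b / N * N + a / N * N ≡⟨ cong (_+ a / N * N) (m≡m%n+[m/n]*n b N) ⟨
    b + a / N * N                 ∎)
    where open ≡-Reasoning

  +-cong : ∀ {a b c d} → a ≈ b → c ≈ d → a + c ≈ b + d
  +-cong {a} {b} {c} {d} p q = begin
    (a + c) % N             ≡⟨ %-distribˡ-+ a c N ⟩
    (a % N + c % N) % N     ≡⟨ cong₂ (λ x y → (x + y) % N) p q ⟩
    (b % N + d % N) % N     ≡⟨ %-distribˡ-+ b d N ⟨
    (b + d) % N             ∎
    where open ≡-Reasoning

  *-cong : ∀ {a b c d} → a ≈ b → c ≈ d → a * c ≈ b * d
  *-cong {a} {b} {c} {d} p q = begin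
    (a * c) % N             ≡⟨ %-distribˡ-* a c N ⟩
    (a % N * (c % N)) % N   ≡⟨ cong₂ (λ x y → (x * y) % N) p q ⟩
    (b % N * (d % N)) % N   ≡⟨ %-distribˡ-* b d N ⟨
    (b * d) % N             ∎
    where open ≡-Reasoning

  +-cancelˡ-≈ : ∀ a {b c} → a + b ≈ a + c → b ≈ c
  +-cancelˡ-≈ a {b} {c} p with ≈⇒≡[mod] p
  ... | k , l , eq = ≡[mod]⇒≈ (k , l , +-cancelˡ-≡ a _ _ (begin
    a + (b + k * N) ≡⟨ +-assoc a b _ ⟨
    a + b + k * N   ≡⟨ eq ⟩
    a + c + l * N   ≡⟨ +-assoc a c _ ⟩
    a + (c + l * N) ∎))
    where open ≡-Reasoning

  -- Not definitional: _%_ only computes once N is of the form suc _.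
  0%N≡0 : 0 % N ≡ 0
  0%N≡0 = m*n%n≡0 0 N

  m*N≈0 : ∀ m → m * N ≈ 0
  m*N≈0 m = trans (m*n%n≡0 m N) (sym 0%N≡0)

  toℕ-mod≈ : ∀ a → toℕ (a mod N) ≈ a
  toℕ-mod≈ a = trans (cong (_% N) (Fin.toℕ-fromℕ< (m%n<n a N))) (m%n%n≡m%n a N)

  ≈-<-injective : ∀ {a b} → a < N → b < N → a ≈ b → a ≡ b
  ≈-<-injective a<N b<N a≈b = trans (sym (m<n⇒m%n≡m a<N)) (trans a≈b (m<n⇒m%n≡m b<N))

  ≈*suc⇒*≈0 : ∀ a c → a ≈ a * suc c → a * c ≈ 0
  ≈*suc⇒*≈0 a c p = sym (+-cancelˡ-≈ a (subst₂ _≈_ (sym (+-identityʳ a)) (*-suc a c) p))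

  ≼-≢⇒≈* : ∀ {x y : Fin N} → x ≼⟨ N ⟩ y → x ≢ y → toℕ x ≈ toℕ x * toℕ y
  ≼-≢⇒≈* (inj₁ x≡y) x≢y = ⊥-elim (x≢y x≡y)
  ≼-≢⇒≈* (inj₂ x≡xy) _  = ≡[mod]⇒≈ x≡xy

∣⇒InIdeal : ∀ {N m} {x : Fin N} → m ∣ toℕ x → InIdeal m x
∣⇒InIdeal (divides q eq) = q , 0 , 0 , cong (_+ 0) eq

module _ (n₁ n₂ : ℕ) .{{_ : NonZero n₁}} .{{_ : NonZero n₂}} where

  private
    N = n₁ * n₂
    instance _ = m*n≢0 n₁ n₂

  open Modulo N

  shift : ℕ → Fin N
  shift t = (1 + t * n₂) mod N

  shift-InShifted : ∀ t → InShifted n₂ (shift t)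
  shift-InShifted t = (t * n₂) mod N , (t , ≈⇒≡[mod] (toℕ-mod≈ (t * n₂))) ,
    ≈⇒≡[mod] (trans (toℕ-mod≈ (1 + t * n₂)) (sym (+-cong {1} refl (toℕ-mod≈ (t * n₂)))))

  InShifted⇒≈ : ∀ {x : Fin N} → InShifted n₂ x → ∃ λ j → toℕ x ≈ 1 + j * n₂
  InShifted⇒≈ (y , (j , y≡jn₂) , x≡1+y) =
    j , trans (≡[mod]⇒≈ x≡1+y) (+-cong {1} refl (≡[mod]⇒≈ y≡jn₂))

  shift-injective : ∀ {s t} → s < n₁ → t < n₁ → shift s ≡ shift t → s ≡ t
  shift-injective {s} {t} s<n₁ t<n₁ eq = *-cancelʳ-≡ s t n₂ (≈-<-injective
    (*-monoˡ-< n₂ s<n₁) (*-monoˡ-< n₂ t<n₁)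
    (+-cancelˡ-≈ 1 (trans (sym (toℕ-mod≈ (1 + s * n₂)))
                   (trans (cong (λ v → toℕ v % N) eq) (toℕ-mod≈ (1 + t * n₂))))))

  below-shift⇒annihilates : ∀ {e : Fin N} t → e ≼⟨ N ⟩ shift t → e ≢ shift t →
                            toℕ e * (t * n₂) ≈ 0
  below-shift⇒annihilates {e} t e≼ e≢ = ≈*suc⇒*≈0 (toℕ e) (t * n₂)
    (trans (≼-≢⇒≈* e≼ e≢) (*-cong {toℕ e} refl (toℕ-mod≈ (1 + t * n₂))))

  annihilates-complement : ∀ a p → n₁ ≡ suc p → a * (p * n₂) ≈ 0 → a * n₂ ≈ 0
  annihilates-complement a p refl apn₂≈0 = begin
    a * n₂                   ≡⟨ +-identityʳ (a * n₂) ⟨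
    a * n₂ + 0               ≈⟨ +-cong {a * n₂} refl (sym apn₂≈0) ⟩
    a * n₂ + a * (p * n₂)    ≡⟨ *-distribˡ-+ a n₂ (p * n₂) ⟨
    a * N                    ≈⟨ m*N≈0 a ⟩
    0                        ∎
    where open ≈-Reasoning

  multiple-absorbs-shifted : ∀ a b k j → a ≈ k * n₁ → b ≈ 1 + j * n₂ → a * b ≈ a
  multiple-absorbs-shifted a b k j a≈ b≈ = begin
    a * b                        ≈⟨ *-cong a≈ b≈ ⟩
    k * n₁ * (1 + j * n₂)        ≡⟨ solve 4 (λ k n₁ j n₂ → k :* n₁ :* (con 1 :+ j :* n₂)
                                      := k :* n₁ :+ k :* j :* (n₁ :* n₂)) refl k n₁ j n₂ ⟩
    k * n₁ + k * j * N           ≈⟨ +-cong {k * n₁} refl (m*N≈0 (k * j)) ⟩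
    k * n₁ + 0                   ≡⟨ +-identityʳ (k * n₁) ⟩
    k * n₁                       ≈⟨ a≈ ⟨
    a                            ∎
    where open ≈-Reasoning

  *n₂≈0⇒n₁∣ : ∀ a → a * n₂ ≈ 0 → n₁ ∣ a
  *n₂≈0⇒n₁∣ a an₂≈0 = *-cancelʳ-∣ n₂ (m%n≡0⇒n∣m (a * n₂) N (trans an₂≈0 0%N≡0))

lemma3p7 : (n₁ n₂ : ℕ) → 3 ≤ n₁ → 1 ≤ n₂ → (e : Fin (n₁ * n₂))
    → InShifted n₂ e
    → (∀ (x : Fin (n₁ * n₂)) → InShifted n₂ x → e ≼⟨ n₁ * n₂ ⟩ x)
    → InIdeal n₁ e × (∀ (x : Fin (n₁ * n₂)) → InIdeal n₁ x → x ≼⟨ n₁ * n₂ ⟩ e)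
lemma3p7 n₁@(suc p@(suc (suc _))) n₂@(suc _) (s≤s (s≤s (s≤s _))) (s≤s _) e e∈J+1 minimal =
  ∣⇒InIdeal n₁∣e , maximal
  where
  open Modulo (n₁ * n₂)

  annihilates : ∀ t → e ≢ shift n₁ n₂ t → toℕ e * (t * n₂) ≈ 0
  annihilates t = below-shift⇒annihilates n₁ n₂ t (minimal _ (shift-InShifted n₁ n₂ t))

  en₂≈0 : toℕ e * n₂ ≈ 0
  en₂≈0 with e Fin.≟ shift n₁ n₂ 1
  ... | no e≢ = subst (λ m → toℕ e * m ≈ 0) (*-identityˡ n₂) (annihilates 1 e≢)
  ... | yes refl = annihilates-complement n₁ n₂ (toℕ e) p refl (annihilates p
        (λ eq → 1≢p (shift-injective n₁ n₂ (s≤s (s≤s z≤n)) ≤-refl eq)))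
    where
    1≢p : 1 ≢ p
    1≢p ()

  n₁∣e : n₁ ∣ toℕ e
  n₁∣e = *n₂≈0⇒n₁∣ n₁ n₂ (toℕ e) en₂≈0

  maximal : ∀ x → InIdeal n₁ x → x ≼⟨ n₁ * n₂ ⟩ e
  maximal x (k , x≡kn₁) with InShifted⇒≈ n₁ n₂ e∈J+1
  ... | j , e≈ = inj₂ (≈⇒≡[mod] (sym
    (multiple-absorbs-shifted n₁ n₂ (toℕ x) (toℕ e) k j (≡[mod]⇒≈ x≡kn₁) e≈)))
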